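{- Let $X$ be a finite set with $|X|\ge2$. Suppose a partition $\mathcal{P}$ of $X$ and a hierarchy $\mathcal{H}$ on $X$ are compatible, and let $A\in\mathcal{P}$. Then $A_{\mathcal{H}}$ does not overlap with any $B\in\mathcal{P}$.
   Context: Two sets $A,B$ overlap if $A\cap B$, $A\setminus B$, $B\setminus A$ are all nonempty. A rooted phylogenetic tree $T$ on $X$ is a rooted tree with leaf set $X$ in which every non-leaf vertex has at least two children. A hierarchy on $X$ is a set system $\mathcal{H}\subseteq 2^X$ with $\emptyset\notin\mathcal{H}$, $X\in\mathcal{H}$, all singletons in $\mathcal{H}$, and no two members overlapping; it corresponds to the unique rooted phylogenetic tree $T$ with $\mathcal{H}=\{L(T(v)):v\in V(T)\}$. For nonempty $A\subseteq X$, $A_{\mathcal{H}}$ is the inclusion-minimal member of $\mathcal{H}$ containing $A$. For $H\subseteq E(T)$, $\mathcal{F}(T,H)$ is the partition of $X$ into leaf sets of the connected components of $T-H$; $\mathcal{P}$ and $\mathcal{H}$ are compatible if $\mathcal{P}=\mathcal{F}(T,H)$ for some $H\subseteq E(T)$. -}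

module Defs where

open import Data.Nat using (ℕ)
open import Data.Fin using (Fin)
open import Data.Fin.Subset using (Subset; _∈_; _∉_; _⊆_; _⊂_; _∩_; _─_; Nonempty; ⊥; ⊤; ⁅_⁆)
open import Data.Product using (Σ; ∃; _×_)
open import Data.Sum using (_⊎_)
open import Relation.Nullary using (¬_)
open import Relation.Binary.PropositionalEquality using (_≡_)
open import Relation.Binary.Construct.Closure.ReflexiveTransitive using (Star)

SetSystem : ℕ → Set₁
SetSystem n = Subset n → Set

Overlap : ∀ {n} → Subset n → Subset n → Set
Overlap A B = Nonempty (A ∩ B) × Nonempty (A ─ B) × Nonempty (B ─ A)

record IsHierarchy {n} (H : SetSystem n) : Set where
  field
    no-empty   : ¬ H ⊥
    has-X      : H ⊤
    singletons : ∀ (x : Fin n) → H ⁅ x ⁆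
    no-overlap : ∀ A B → H A → H B → ¬ Overlap A B

record IsPartition {n} (P : SetSystem n) : Set where
  field
    blocks-nonempty : ∀ A → P A → Nonempty A
    cover           : ∀ (x : Fin n) → ∃ λ A → P A × x ∈ A
    disjoint        : ∀ A B → P A → P B → Nonempty (A ∩ B) → A ≡ B

-- The rooted phylogenetic tree T associated with the hierarchy H:
-- its vertices are the clusters of H (vertex v ↔ L(T(v))), the leaf x ↔ ⁅ x ⁆,
-- and there is an edge (C , D) with child C and parent D iff C ⊂ D are clusters
-- with no cluster strictly between them (the Hasse diagram of (H, ⊆)).
TreeEdge : ∀ {n} → SetSystem n → Subset n → Subset n → Set
TreeEdge H C D = H C × H D × C ⊂ D × (∀ E → H E → C ⊂ E → ¬ (E ⊂ D))

-- An edge set Hc ⊆ E(T), given as a predicate on (child , parent) pairs.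
EdgeSet : ℕ → Set₁
EdgeSet n = Subset n → Subset n → Set

AdjMinus : ∀ {n} → SetSystem n → EdgeSet n → Subset n → Subset n → Set
AdjMinus H Hc u v = (TreeEdge H u v × ¬ Hc u v) ⊎ (TreeEdge H v u × ¬ Hc v u)

Connected : ∀ {n} → SetSystem n → EdgeSet n → Subset n → Subset n → Set
Connected H Hc = Star (AdjMinus H Hc)

IsComponentLeafSet : ∀ {n} → SetSystem n → EdgeSet n → Subset n → Set
IsComponentLeafSet {n} H Hc A =
  ∃ λ (x : Fin n) → ∀ (y : Fin n) → (y ∈ A → Connected H Hc ⁅ x ⁆ ⁅ y ⁆) × (Connected H Hc ⁅ x ⁆ ⁅ y ⁆ → y ∈ A)

IsF : ∀ {n} → SetSystem n → EdgeSet n → SetSystem n → Set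
IsF H Hc P = ∀ A → (P A → IsComponentLeafSet H Hc A) × (IsComponentLeafSet H Hc A → P A)

Compatible : ∀ {n} → SetSystem n → SetSystem n → Set₁
Compatible {n} P H = Σ (EdgeSet n) λ Hc → (∀ C D → Hc C D → TreeEdge H C D) × IsF H Hc P

IsMinCluster : ∀ {n} → SetSystem n → Subset n → Subset n → Set
IsMinCluster H A M = H M × A ⊆ M × (∀ M′ → H M′ → A ⊆ M′ → M ⊆ M′)

{-# OPTIONS --safe #-}
-- In the forest T − Hc, a path that starts below a cluster C and ends outside C must pass
-- through C itself: the only tree edge leaving the subtree of C joins C to its parent.
-- Following the paths between the leaves of a block A and taking upper bounds, the component
-- of A contains a cluster V ⊇ A, hence V ⊇ A_H, and so it contains the vertex A_H.  If A_H
-- overlapped a block B, with y ∈ A_H ∩ B and z ∈ B ∖ A_H, the path from y to z would leave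
-- the subtree of A_H and so pass through A_H; then B is the component of A, so B = A ⊆ A_H,
-- contradicting z ∉ A_H.
module Submission where

open import Defs
open import Data.Nat using (ℕ; _≤_)
open import Data.Fin using (Fin; zero; suc)
open import Data.Fin.Subset using (Subset; _∈_; _∉_; _⊆_; _⊈_; _⊂_; _─_; Nonempty; ⁅_⁆; inside; outside)
open import Data.Fin.Subset.Properties using (_∈?_; _⊆?_; ⊆-refl; ⊆-trans; ⊆-antisym; Empty-unique; nonempty?; x∈⁅x⁆; x∈⁅y⁆⇒x≡y; x∈p∩q⁺; x∈p∩q⁻)
open import Data.Fin.Properties using (¬∀⟶∃¬)
open import Data.Vec.Base using (_∷_; here; there)
open import Data.Product using (∃; _×_; _,_; proj₁; proj₂)
open import Data.Sum using (_⊎_; inj₁; inj₂)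
open import Data.List using (List; []; _∷_; allFin; filter)
open import Data.List.Membership.Propositional using () renaming (_∈_ to _∈ₗ_)
open import Data.List.Membership.Propositional.Properties using (∈-allFin; ∈-filter⁺; ∈-filter⁻)
open import Data.List.Relation.Unary.Any using () renaming (here to hereₗ; there to thereₗ)
open import Data.Empty using (⊥-elim)
open import Relation.Nullary using (¬_; yes; no; contradiction)
open import Relation.Nullary.Decidable using (_→-dec_; decidable-stable)
open import Relation.Binary.PropositionalEquality using (_≡_; refl; subst; sym)
open import Relation.Binary.Construct.Closure.ReflexiveTransitive using (ε; _◅_; _◅◅_; reverse)

x∈p─q⁺ : ∀ {n} {x : Fin n} {p q : Subset n} → x ∈ p → x ∉ q → x ∈ p ─ q
x∈p─q⁺ {p = inside ∷ p} {inside  ∷ q} here      x∉q = contradiction here x∉q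
x∈p─q⁺ {p = inside ∷ p} {outside ∷ q} here      x∉q = here
x∈p─q⁺ {p = _ ∷ p}      {inside  ∷ q} (there x∈p) x∉q = there (x∈p─q⁺ x∈p (λ x∈q → x∉q (there x∈q)))
x∈p─q⁺ {p = _ ∷ p}      {outside ∷ q} (there x∈p) x∉q = there (x∈p─q⁺ x∈p (λ x∈q → x∉q (there x∈q)))

x∈p─q⁻ : ∀ {n} {x : Fin n} (p q : Subset n) → x ∈ p ─ q → x ∈ p × x ∉ q
x∈p─q⁻ {x = zero}  (inside ∷ p) (outside ∷ q) here = here , λ ()
x∈p─q⁻ {x = suc _} (_ ∷ p)      (_ ∷ q)       (there x∈p─q) with x∈p─q⁻ p q x∈p─q
... | x∈p , x∉q = there x∈p , λ { (there x∈q) → x∉q x∈q }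

p⊈q⇒∃∉ : ∀ {n} {p q : Subset n} → p ⊈ q → ∃ λ x → x ∈ p × x ∉ q
p⊈q⇒∃∉ {n} {p} {q} p⊈q =
  let x , x∈p⇏x∈q = ¬∀⟶∃¬ n (λ x → x ∈ p → x ∈ q) (λ x → x ∈? p →-dec x ∈? q) (λ p⊆q → p⊈q (p⊆q _))
  in x , decidable-stable (x ∈? p) (λ x∉p → x∈p⇏x∈q (λ x∈p → contradiction x∈p x∉p))
       , λ x∈q → x∈p⇏x∈q (λ _ → x∈q)

p⊆q∧q⊈p⇒p⊂q : ∀ {n} {p q : Subset n} → p ⊆ q → q ⊈ p → p ⊂ q
p⊆q∧q⊈p⇒p⊂q p⊆q q⊈p = p⊆q , p⊈q⇒∃∉ q⊈p

x∈p⇒⁅x⁆⊆p : ∀ {n} {x : Fin n} {p : Subset n} → x ∈ p → ⁅ x ⁆ ⊆ p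
x∈p⇒⁅x⁆⊆p {x = x} {p} x∈p y∈⁅x⁆ = subst (_∈ p) (sym (x∈⁅y⁆⇒x≡y x y∈⁅x⁆)) x∈p

module _ {n} {H : SetSystem n} (hH : IsHierarchy H) where
  open IsHierarchy hH

  cluster-nonempty : ∀ {C} → H C → Nonempty C
  cluster-nonempty {C} H-C with nonempty? C
  ... | yes C-nonempty = C-nonempty
  ... | no C-empty     = contradiction (subst H (Empty-unique C-empty) H-C) no-empty

  clusters-nested : ∀ {C D x} → H C → H D → x ∈ C → x ∈ D → C ⊆ D ⊎ D ⊆ C
  clusters-nested {C} {D} {x} H-C H-D x∈C x∈D with C ⊆? D | D ⊆? C
  ... | yes C⊆D | _       = inj₁ C⊆D
  ... | no _    | yes D⊆C = inj₂ D⊆C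
  ... | no C⊈D  | no D⊈C  =
    let y , y∈C , y∉D = p⊈q⇒∃∉ C⊈D
        z , z∈D , z∉C = p⊈q⇒∃∉ D⊈C
    in contradiction ((x , x∈p∩q⁺ (x∈C , x∈D)) , (y , x∈p─q⁺ y∈C y∉D) , (z , x∈p─q⁺ z∈D z∉C))
                     (no-overlap C D H-C H-D)

module Forest {n} (H : SetSystem n) (Hc : EdgeSet n) where

  _~_ : Subset n → Subset n → Set
  _~_ = Connected H Hc

  adj-sym : ∀ {u v} → AdjMinus H Hc u v → AdjMinus H Hc v u
  adj-sym (inj₁ e) = inj₂ e
  adj-sym (inj₂ e) = inj₁ e

  connected-sym : ∀ {u v} → u ~ v → v ~ u
  connected-sym = reverse adj-sym

  adj-clusters : ∀ {u v} → AdjMinus H Hc u v → H u × H v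
  adj-clusters (inj₁ ((H-u , H-v , _) , _)) = H-u , H-v
  adj-clusters (inj₂ ((H-v , H-u , _) , _)) = H-u , H-v

  component-connected : ∀ {A x y} → IsComponentLeafSet H Hc A → x ∈ A → y ∈ A → ⁅ x ⁆ ~ ⁅ y ⁆
  component-connected {x = x} {y} (_ , r~A) x∈A y∈A =
    connected-sym (proj₁ (r~A x) x∈A) ◅◅ proj₁ (r~A y) y∈A

  component-closed : ∀ {A x y} → IsComponentLeafSet H Hc A → x ∈ A → ⁅ x ⁆ ~ ⁅ y ⁆ → y ∈ A
  component-closed {x = x} {y} (_ , r~A) x∈A x~y = proj₂ (r~A y) (proj₁ (r~A x) x∈A ◅◅ x~y)

module HierarchyForest {n} {H : SetSystem n} (hH : IsHierarchy H) (Hc : EdgeSet n) where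
  open IsHierarchy hH
  open Forest H Hc public

  -- The cover condition of TreeEdge rules out u ⊂ C ⊂ v.
  adj-leaving-cluster : ∀ {u v C} → H C → u ⊆ C → v ⊈ C → AdjMinus H Hc u v → u ≡ C
  adj-leaving-cluster {u} {C = C} H-C u⊆C v⊈C (inj₁ ((H-u , H-v , (u⊆v , _) , cover) , _))
    with cluster-nonempty hH H-u
  ... | x , x∈u with clusters-nested hH H-C H-v (u⊆C x∈u) (u⊆v x∈u)
  ...   | inj₂ v⊆C = ⊥-elim (v⊈C v⊆C)
  ...   | inj₁ C⊆v with C ⊆? u
  ...     | yes C⊆u = ⊆-antisym u⊆C C⊆u
  ...     | no C⊈u  = contradiction (p⊆q∧q⊈p⇒p⊂q C⊆v v⊈C) (cover C H-C (p⊆q∧q⊈p⇒p⊂q u⊆C C⊈u))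
  adj-leaving-cluster H-C u⊆C v⊈C (inj₂ ((_ , _ , (v⊆u , _) , _) , _)) =
    ⊥-elim (v⊈C (⊆-trans v⊆u u⊆C))

  connected-leaving-cluster : ∀ {u w C} → H C → u ⊆ C → w ⊈ C → u ~ w → u ~ C
  connected-leaving-cluster H-C u⊆C w⊈C ε = ⊥-elim (w⊈C u⊆C)
  connected-leaving-cluster {u} {C = C} H-C u⊆C w⊈C (_◅_ {j = v} u-v v~w) with v ⊆? C
  ... | yes v⊆C = u-v ◅ connected-leaving-cluster H-C v⊆C w⊈C v~w
  ... | no v⊈C  = subst (u ~_) (adj-leaving-cluster H-C u⊆C v⊈C u-v) ε

  adj-below-cluster : ∀ {u u′ v} → AdjMinus H Hc u u′ → H v → u′ ⊆ v → u ⊆ v ⊎ v ⊆ u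
  adj-below-cluster (inj₁ ((_ , _ , (u⊆u′ , _) , _) , _)) H-v u′⊆v = inj₁ (⊆-trans u⊆u′ u′⊆v)
  adj-below-cluster (inj₂ ((H-u′ , H-u , (u′⊆u , _) , _) , _)) H-v u′⊆v =
    let x , x∈u′ = cluster-nonempty hH H-u′
    in clusters-nested hH H-u H-v (u′⊆u x∈u′) (u′⊆v x∈u′)

  connected-upper-bound : ∀ {u w} → H u → u ~ w → ∃ λ v → H v × u ~ v × u ⊆ v × w ⊆ v
  connected-upper-bound {u} H-u ε = u , H-u , ε , ⊆-refl , ⊆-refl
  connected-upper-bound {u} H-u (u-u′ ◅ u′~w)
    with connected-upper-bound (proj₂ (adj-clusters u-u′)) u′~w
  ... | v , H-v , u′~v , u′⊆v , w⊆v with adj-below-cluster u-u′ H-v u′⊆v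
  ...   | inj₁ u⊆v = v , H-v , u-u′ ◅ u′~v , u⊆v , w⊆v
  ...   | inj₂ v⊆u = u , H-u , ε , ⊆-refl , ⊆-trans w⊆v v⊆u

  connected-cover : ∀ {u} → H u → (xs : List (Fin n)) → (∀ {x} → x ∈ₗ xs → u ~ ⁅ x ⁆) →
                    ∃ λ V → H V × u ~ V × (∀ {x} → x ∈ₗ xs → x ∈ V)
  connected-cover {u} H-u [] _ = u , H-u , ε , λ ()
  connected-cover H-u (x ∷ xs) u~x∷xs
    with connected-cover H-u xs (λ x′∈xs → u~x∷xs (thereₗ x′∈xs))
  ... | V , H-V , u~V , xs⊆V
    with connected-upper-bound H-V (connected-sym u~V ◅◅ u~x∷xs (hereₗ refl))
  ...   | W , H-W , V~W , V⊆W , ⁅x⁆⊆W = W , H-W , u~V ◅◅ V~W , λ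
    { (hereₗ refl)    → ⁅x⁆⊆W (x∈⁅x⁆ x)
    ; (thereₗ x′∈xs) → V⊆W (xs⊆V x′∈xs) }

  connected-cluster-⊇ : ∀ {u} → H u → (A : Subset n) → (∀ {x} → x ∈ A → u ~ ⁅ x ⁆) →
                        ∃ λ V → H V × u ~ V × A ⊆ V
  connected-cluster-⊇ H-u A u~A
    with connected-cover H-u (filter (_∈? A) (allFin n))
                         (λ x∈A′ → u~A (proj₂ (∈-filter⁻ (_∈? A) {xs = allFin n} x∈A′)))
  ... | V , H-V , u~V , A′⊆V = V , H-V , u~V , λ x∈A → A′⊆V (∈-filter⁺ (_∈? A) (∈-allFin _) x∈A)

  min-cluster-connected : ∀ {A M a} → IsMinCluster H A M → a ∈ A →
                          (∀ {x} → x ∈ A → ⁅ a ⁆ ~ ⁅ x ⁆) → ⁅ a ⁆ ~ M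
  min-cluster-connected {A} {M} {a} (H-M , A⊆M , M-min) a∈A a~A
    with connected-cluster-⊇ (singletons a) A a~A
  ... | V , H-V , a~V , A⊆V with V ⊆? M
  ...   | yes V⊆M = subst (⁅ a ⁆ ~_) (⊆-antisym V⊆M (M-min V H-V A⊆V)) a~V
  ...   | no V⊈M  = connected-leaving-cluster H-M (x∈p⇒⁅x⁆⊆p (A⊆M a∈A)) V⊈M a~V

lemma4p4 : (n : ℕ) → 2 ≤ n → (P H : SetSystem n) → IsPartition P → IsHierarchy H → Compatible P H → (A : Subset n) → P A → (AH : Subset n) → IsMinCluster H A AH → (B : Subset n) → P B → ¬ Overlap AH B
lemma4p4 n _ P H hP hH (Hc , _ , P≡F) A PA AH AH-min@(H-AH , A⊆AH , _) B PB
         ((y , y∈AH∩B) , _ , (z , z∈B─AH)) = z∉AH (A⊆AH z∈A)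
  where
  open IsPartition hP
  open HierarchyForest hH Hc

  A-component : IsComponentLeafSet H Hc A
  A-component = proj₁ (P≡F A) PA

  B-component : IsComponentLeafSet H Hc B
  B-component = proj₁ (P≡F B) PB

  a : Fin n
  a = proj₁ (blocks-nonempty A PA)

  a∈A : a ∈ A
  a∈A = proj₂ (blocks-nonempty A PA)

  y∈AH : y ∈ AH
  y∈AH = proj₁ (x∈p∩q⁻ AH B y∈AH∩B)

  y∈B : y ∈ B
  y∈B = proj₂ (x∈p∩q⁻ AH B y∈AH∩B)

  z∈B : z ∈ B
  z∈B = proj₁ (x∈p─q⁻ B AH z∈B─AH)

  z∉AH : z ∉ AH
  z∉AH = proj₂ (x∈p─q⁻ B AH z∈B─AH)

  a~AH : ⁅ a ⁆ ~ AH
  a~AH = min-cluster-connected AH-min a∈A (component-connected A-component a∈A)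

  y~AH : ⁅ y ⁆ ~ AH
  y~AH = connected-leaving-cluster H-AH (x∈p⇒⁅x⁆⊆p y∈AH) (λ ⁅z⁆⊆AH → z∉AH (⁅z⁆⊆AH (x∈⁅x⁆ z)))
           (component-connected B-component y∈B z∈B)

  a∈B : a ∈ B
  a∈B = component-closed B-component y∈B (y~AH ◅◅ connected-sym a~AH)

  z∈A : z ∈ A
  z∈A = subst (z ∈_) (sym (disjoint A B PA PB (a , x∈p∩q⁺ (a∈A , a∈B)))) z∈B
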